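{- Let $m,n$ be positive integers and let $b_i=m(i-1)$ for $i=1,2,\ldots$. Then for every positive integer $k$, \[C^{(\mathbf b)}(n,k)=m^k\binom{n-1}{2k-1}.\]
   Context: Given a sequence $\mathbf b=(b_1,b_2,\ldots)$ of nonnegative integers and positive integers $n,k$, $C^{(\mathbf b)}(n,k)=\sum b_{i_1}\cdots b_{i_k}$, the sum over all $k$-tuples $(i_1,\ldots,i_k)$ of positive integers with sum $n$ (number of compositions of $n$ with $k$ parts where a part equal to $j$ comes in $b_j$ types). Binomial coefficients $\binom{a}{b}$ are $0$ when $a<b$. -}

module Defs where

open import Data.Nat using (ℕ; zero; suc; _+_; _*_; _∸_)
open import Data.List using (List; []; _∷_; map; concatMap; upTo)
open import Data.Nat.ListAction using (sum; product)

compositions : ℕ → ℕ → List (List ℕ)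
compositions zero    zero    = [] ∷ []
compositions (suc n) zero    = []
compositions n       (suc k) =
  concatMap (λ j → map (suc j ∷_) (compositions (n ∸ suc j) k)) (upTo n)

-- Cb b n k = C^(b)(n,k) = Σ over compositions (i₁,…,iₖ) of n of b_{i₁}⋯b_{iₖ}.
-- The sequence b = (b₁,b₂,…) is given as a function ℕ → ℕ; b i is b_i (b 0 unused).
Cb : (ℕ → ℕ) → ℕ → ℕ → ℕ
Cb b n k = sum (map (λ c → product (map b c)) (compositions n k))

module Submission where

-- Splitting off the first part i₁ = j + 1 of a composition gives the
-- recursion  C(n, k+1) = Σ_{j<n} b_{j+1} · C(n-1-j, k),  i.e. C(·,k+1) is the
-- convolution of the shifted weights j ↦ b_{j+1} with C(·,k).  For b_i = m(i-1)
-- the shifted weights are j ↦ m·j, so by induction on k it suffices to know how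
-- convolution with j ↦ j acts on the family u_a(r) = (r-1 choose a):
--   * convolving u_{a+1} with the constant 1 gives u_{a+2}    (hockey stick),
--   * convolving u_{a+1} with j ↦ j gives u_{a+3},
-- both by induction on n and Pascal's rule (the second reduces to the first via
-- j+1 = j + 1).  The base case k = 1 holds since C(·,0) is the unit of convolution.

open import Defs
open import Data.Nat using (ℕ; zero; suc; _+_; _*_; _∸_; _^_; NonZero)
open import Data.Nat.Properties
  using (+-identityʳ; *-identityʳ; *-zeroʳ; *-distribˡ-+; *-distribʳ-+; *-assoc; *-comm; *-suc;
         +-comm; +-assoc)
open import Data.Nat.Combinatorics using (_C_; nC1≡n; nCk+nC[k+1]≡[n+1]C[k+1])
open import Data.Nat.ListAction using (sum; product)
open import Data.Nat.ListAction.Properties using (sum-++)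
open import Data.List using (List; []; _∷_; map; concatMap; upTo; applyUpTo; _++_)
open import Data.List.Properties using (map-++)
open import Function using (_∘_)
open import Relation.Binary.PropositionalEquality
  using (_≡_; refl; sym; trans; cong; cong₂; module ≡-Reasoning)
open ≡-Reasoning

sumTo : (ℕ → ℕ) → ℕ → ℕ
sumTo ψ zero    = 0
sumTo ψ (suc n) = ψ 0 + sumTo (ψ ∘ suc) n

sumTo-cong : ∀ n {ψ ψ′ : ℕ → ℕ} → (∀ j → ψ j ≡ ψ′ j) → sumTo ψ n ≡ sumTo ψ′ n
sumTo-cong zero    eq = refl
sumTo-cong (suc n) eq = cong₂ _+_ (eq 0) (sumTo-cong n (eq ∘ suc))

sumTo-+ : ∀ n (φ ψ : ℕ → ℕ) → sumTo (λ j → φ j + ψ j) n ≡ sumTo φ n + sumTo ψ n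
sumTo-+ zero    φ ψ = refl
sumTo-+ (suc n) φ ψ = begin
  (φ 0 + ψ 0) + sumTo (λ j → φ (suc j) + ψ (suc j)) n
    ≡⟨ cong ((φ 0 + ψ 0) +_) (sumTo-+ n (φ ∘ suc) (ψ ∘ suc)) ⟩
  (φ 0 + ψ 0) + (Φ + Ψ)   ≡⟨ interchange (φ 0) (ψ 0) Φ Ψ ⟩
  (φ 0 + Φ) + (ψ 0 + Ψ)   ∎
  where
  Φ = sumTo (φ ∘ suc) n
  Ψ = sumTo (ψ ∘ suc) n
  interchange : ∀ a b c d → (a + b) + (c + d) ≡ (a + c) + (b + d)
  interchange a b c d = begin
    (a + b) + (c + d)  ≡⟨ +-assoc a b (c + d) ⟩
    a + (b + (c + d))  ≡⟨ cong (a +_) (sym (+-assoc b c d)) ⟩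
    a + ((b + c) + d)  ≡⟨ cong (λ x → a + (x + d)) (+-comm b c) ⟩
    a + ((c + b) + d)  ≡⟨ cong (a +_) (+-assoc c b d) ⟩
    a + (c + (b + d))  ≡⟨ sym (+-assoc a c (b + d)) ⟩
    (a + c) + (b + d)  ∎

sumTo-*ˡ : ∀ n c (ψ : ℕ → ℕ) → sumTo (λ j → c * ψ j) n ≡ c * sumTo ψ n
sumTo-*ˡ zero    c ψ = sym (*-zeroʳ c)
sumTo-*ˡ (suc n) c ψ =
  trans (cong (c * ψ 0 +_) (sumTo-*ˡ n c (ψ ∘ suc))) (sym (*-distribˡ-+ c (ψ 0) _))

sum-applyUpTo : ∀ n (φ f : ℕ → ℕ) → sum (map φ (applyUpTo f n)) ≡ sumTo (φ ∘ f) n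
sum-applyUpTo zero    φ f = refl
sum-applyUpTo (suc n) φ f = cong (φ (f 0) +_) (sum-applyUpTo n φ (f ∘ suc))

-- Convolution  (g ⋆ h)(n) = Σ_{j<n} g j · h (n-1-j).  Unfolding the sum shows
-- (g ⋆ h)(n+1) = g 0 · h n + ((g ∘ suc) ⋆ h)(n) definitionally; this drives all inductions.
conv : (ℕ → ℕ) → (ℕ → ℕ) → ℕ → ℕ
conv g h n = sumTo (λ j → g j * h (n ∸ suc j)) n

conv-congʳ : ∀ n g {h h′ : ℕ → ℕ} → (∀ r → h r ≡ h′ r) → conv g h n ≡ conv g h′ n
conv-congʳ n g eq = sumTo-cong n (λ j → cong (g j *_) (eq (n ∸ suc j)))

conv-scale : ∀ n a c (g h : ℕ → ℕ) →
  conv (λ j → a * g j) (λ r → c * h r) n ≡ (a * c) * conv g h n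
conv-scale n a c g h = trans (sumTo-cong n (λ j → regroup (g j) (h (n ∸ suc j))))
                             (sumTo-*ˡ n (a * c) (λ j → g j * h (n ∸ suc j)))
  where
  regroup : ∀ x y → a * x * (c * y) ≡ a * c * (x * y)
  regroup x y = begin
    a * x * (c * y)    ≡⟨ *-assoc a x (c * y) ⟩
    a * (x * (c * y))  ≡⟨ cong (a *_) (sym (*-assoc x c y)) ⟩
    a * (x * c * y)    ≡⟨ cong (λ z → a * (z * y)) (*-comm x c) ⟩
    a * (c * x * y)    ≡⟨ cong (a *_) (*-assoc c x y) ⟩
    a * (c * (x * y))  ≡⟨ sym (*-assoc a c (x * y)) ⟩
    a * c * (x * y)    ∎

conv-suc : ∀ n (g h : ℕ → ℕ) → conv (suc ∘ g) h n ≡ conv g h n + conv (λ _ → 1) h n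
conv-suc n g h = trans (sumTo-cong n split) (sumTo-+ n _ _)
  where
  split : ∀ j → suc (g j) * h (n ∸ suc j) ≡ g j * h (n ∸ suc j) + 1 * h (n ∸ suc j)
  split j = trans (cong (_* h (n ∸ suc j)) (+-comm 1 (g j))) (*-distribʳ-+ (h (n ∸ suc j)) (g j) 1)

Cb-suc : ∀ b n k → Cb b n (suc k) ≡ conv (b ∘ suc) (λ r → Cb b r k) n
Cb-suc b zero    k = refl
Cb-suc b n@(suc _) k = begin
  sum (map weight (concatMap firstPart (upTo n)))
    ≡⟨ sum-concatMap (upTo n) ⟩
  sum (map (λ j → sum (map weight (firstPart j))) (upTo n))
    ≡⟨ sum-applyUpTo n _ (λ j → j) ⟩
  sumTo (λ j → sum (map weight (firstPart j))) n
    ≡⟨ sumTo-cong n (λ j → sum-prepend (suc j) (compositions (n ∸ suc j) k)) ⟩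
  conv (b ∘ suc) (λ r → Cb b r k) n  ∎
  where
  weight : List ℕ → ℕ
  weight c = product (map b c)
  firstPart : ℕ → List (List ℕ)
  firstPart j = map (suc j ∷_) (compositions (n ∸ suc j) k)
  sum-concatMap : ∀ js → sum (map weight (concatMap firstPart js))
                       ≡ sum (map (λ j → sum (map weight (firstPart j))) js)
  sum-concatMap []       = refl
  sum-concatMap (j ∷ js) = begin
    sum (map weight (firstPart j ++ concatMap firstPart js))
      ≡⟨ cong sum (map-++ weight (firstPart j) (concatMap firstPart js)) ⟩
    sum (map weight (firstPart j) ++ map weight (concatMap firstPart js))
      ≡⟨ sum-++ (map weight (firstPart j)) _ ⟩
    sum (map weight (firstPart j)) + sum (map weight (concatMap firstPart js))
      ≡⟨ cong (sum (map weight (firstPart j)) +_) (sum-concatMap js) ⟩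
    sum (map weight (firstPart j)) + sum (map (λ j → sum (map weight (firstPart j))) js)  ∎
  sum-prepend : ∀ i cs → sum (map weight (map (i ∷_) cs)) ≡ b i * sum (map weight cs)
  sum-prepend i []       = sym (*-zeroʳ (b i))
  sum-prepend i (c ∷ cs) = trans (cong (b i * weight c +_) (sum-prepend i cs))
                                 (sym (*-distribˡ-+ (b i) (weight c) _))

-- C(·,0) is the indicator of 0, the unit of convolution.
conv-Cb-zero : ∀ (g b : ℕ → ℕ) n → conv g (λ r → Cb b r 0) (suc n) ≡ g n
conv-Cb-zero g b zero    = trans (+-identityʳ _) (*-identityʳ (g 0))
conv-Cb-zero g b (suc n) =
  trans (cong (_+ conv (g ∘ suc) (λ r → Cb b r 0) (suc n)) (*-zeroʳ (g 0)))
        (conv-Cb-zero (g ∘ suc) b n)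

u : ℕ → ℕ → ℕ
u a r = (r ∸ 1) C a

conv-one-u : ∀ a n → conv (λ _ → 1) (u (suc a)) n ≡ u (suc (suc a)) n
conv-one-u a zero          = refl
conv-one-u a (suc zero)    = refl
conv-one-u a (suc (suc n)) = begin
  (n C suc a + 0) + conv (λ _ → 1) (u (suc a)) (suc n)
    ≡⟨ cong₂ _+_ (+-identityʳ _) (conv-one-u a (suc n)) ⟩
  n C suc a + n C suc (suc a)
    ≡⟨ nCk+nC[k+1]≡[n+1]C[k+1] n (suc a) ⟩
  suc n C suc (suc a)  ∎

conv-id-u : ∀ a n → conv (λ j → j) (u (suc a)) n ≡ u (suc (suc (suc a))) n
conv-id-u a zero          = refl
conv-id-u a (suc zero)    = refl
conv-id-u a (suc (suc n)) = begin
  conv suc (u (suc a)) (suc n)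
    ≡⟨ conv-suc (suc n) (λ j → j) (u (suc a)) ⟩
  conv (λ j → j) (u (suc a)) (suc n) + conv (λ _ → 1) (u (suc a)) (suc n)
    ≡⟨ cong₂ _+_ (conv-id-u a (suc n)) (conv-one-u a (suc n)) ⟩
  n C suc (suc (suc a)) + n C suc (suc a)
    ≡⟨ +-comm _ (n C suc (suc a)) ⟩
  n C suc (suc a) + n C suc (suc (suc a))
    ≡⟨ nCk+nC[k+1]≡[n+1]C[k+1] n (suc (suc a)) ⟩
  suc n C suc (suc (suc a))  ∎

linearWeights : ℕ → ℕ → ℕ
linearWeights m i = m * (i ∸ 1)

Cb-linearWeights : ∀ m k n → Cb (linearWeights m) n (suc k) ≡ m ^ suc k * u (suc (2 * k)) n
Cb-linearWeights m zero zero = sym (*-zeroʳ (m * 1))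
Cb-linearWeights m zero n@(suc n′) = begin
  Cb b n 1                                   ≡⟨ Cb-suc b n 0 ⟩
  conv (λ j → m * j) (λ r → Cb b r 0) n       ≡⟨ conv-Cb-zero (λ j → m * j) b n′ ⟩
  m * n′                                     ≡⟨ cong₂ _*_ (sym (*-identityʳ m)) (sym (nC1≡n n′)) ⟩
  m ^ 1 * u 1 n                              ∎
  where b = linearWeights m
Cb-linearWeights m (suc k) n = begin
  Cb b n (suc (suc k))
    ≡⟨ Cb-suc b n (suc k) ⟩
  conv (λ j → m * j) (λ r → Cb b r (suc k)) n
    ≡⟨ conv-congʳ n (λ j → m * j) (Cb-linearWeights m k) ⟩
  conv (λ j → m * j) (λ r → m ^ suc k * u (suc (2 * k)) r) n
    ≡⟨ conv-scale n m (m ^ suc k) (λ j → j) (u (suc (2 * k))) ⟩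
  m ^ suc (suc k) * conv (λ j → j) (u (suc (2 * k))) n
    ≡⟨ cong (m ^ suc (suc k) *_) (conv-id-u (2 * k) n) ⟩
  m ^ suc (suc k) * u (suc (suc (suc (2 * k)))) n
    ≡⟨ cong (λ i → m ^ suc (suc k) * u (suc i) n) (sym (*-suc 2 k)) ⟩
  m ^ suc (suc k) * u (suc (2 * suc k)) n  ∎
  where b = linearWeights m

proposition7 : (m n k : ℕ) → .{{_ : NonZero m}} → .{{_ : NonZero n}} → .{{_ : NonZero k}}
    → Cb (λ i → m * (i ∸ 1)) n k ≡ m ^ k * ((n ∸ 1) C (2 * k ∸ 1))
proposition7 m n (suc k) = begin
  Cb (linearWeights m) n (suc k)        ≡⟨ Cb-linearWeights m k n ⟩
  m ^ suc k * u (suc (2 * k)) n         ≡⟨ cong (λ i → m ^ suc k * u (i ∸ 1) n) (sym (*-suc 2 k)) ⟩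
  m ^ suc k * u (2 * suc k ∸ 1) n       ∎
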